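{- For every positive integer $n$, the largest skew corner-free subset of $[n]^2$ is at least as large as the largest skew-corner free subset of $\Delta_n$.
   Context: $[n]=\{1,\dots,n\}$. A set $S\subseteq[n]^2$ is skew corner-free if it contains no three points of the form $(x,y),(x,y+d),(x+d,y')$ with $d\neq0$. $\Delta_n=\{(a,b,c)\in\mathbb{Z}_{\ge0}^3: a+b+c=n-1\}$. A set $S\subseteq\Delta_n$ is skew-corner free if, for every permutation $\sigma$ of the three coordinates, the set $\sigma(S)$ has the property: whenever $(a,b,c),(a,b',c')\in\sigma(S)$ with $b\neq b'$, there is no point of $\sigma(S)$ whose first coordinate equals $a+b-b'$. -}

module Defs where

open import Data.Nat using (ℕ; zero; suc; _+_; _∸_; _≤_)
open import Data.Integer as ℤ using (ℤ; +_)
open import Data.Fin using (Fin; zero; suc)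
open import Data.Fin.Permutation using (Permutation′; _⟨$⟩ʳ_)
open import Data.Product using (_×_; _,_; ∃; ∃-syntax; proj₁; proj₂)
open import Data.List using (List; length)
open import Data.List.Membership.Propositional using (_∈_)
open import Data.List.Relation.Unary.Unique.Propositional using (Unique)
open import Relation.Binary.PropositionalEquality using (_≡_; _≢_)
open import Relation.Nullary using (¬_)
open import Data.Empty using (⊥)

-- A finite subset of a type is represented by a duplicate-free list;
-- its cardinality is the length of the list.

Point2 : Set
Point2 = ℕ × ℕ

InGrid : ℕ → Point2 → Set
InGrid n (x , y) = (1 ≤ x × x ≤ n) × (1 ≤ y × y ≤ n)

SkewCornerFree2 : List Point2 → Set
SkewCornerFree2 S =
  ∀ (x y y' x'' y'' : ℕ) (d : ℤ) → d ≢ + 0 →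
    (x , y) ∈ S → (x , y') ∈ S → (x'' , y'') ∈ S →
    + y' ≡ (+ y) ℤ.+ d → + x'' ≡ (+ x) ℤ.+ d → ⊥

IsGridSubset : ℕ → List Point2 → Set
IsGridSubset n S = Unique S × (∀ {p} → p ∈ S → InGrid n p)

Point3 : Set
Point3 = ℕ × ℕ × ℕ

InTriangle : ℕ → Point3 → Set
InTriangle n (a , b , c) = a + b + c ≡ n ∸ 1

coord : Point3 → Fin 3 → ℕ
coord (a , b , c) zero = a
coord (a , b , c) (suc zero) = b
coord (a , b , c) (suc (suc zero)) = c

permute : Permutation′ 3 → Point3 → Point3
permute σ p = coord p (σ ⟨$⟩ʳ zero) , coord p (σ ⟨$⟩ʳ suc zero) , coord p (σ ⟨$⟩ʳ suc (suc zero))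

_∈ᵖ_ : Point3 → (Permutation′ 3 × List Point3) → Set
q ∈ᵖ (σ , S) = ∃[ p ] (p ∈ S × permute σ p ≡ q)

SkewProp : Permutation′ 3 → List Point3 → Set
SkewProp σ S =
  ∀ (a b c b' c' : ℕ) (q : Point3) →
    (a , b , c) ∈ᵖ (σ , S) → (a , b' , c') ∈ᵖ (σ , S) → b ≢ b' →
    q ∈ᵖ (σ , S) → ¬ ((+ proj₁ q) ≡ ((+ a) ℤ.+ (+ b)) ℤ.- (+ b'))

SkewCornerFree3 : List Point3 → Set
SkewCornerFree3 S = ∀ (σ : Permutation′ 3) → SkewProp σ S

IsTriangleSubset : ℕ → List Point3 → Set
IsTriangleSubset n S = Unique S × (∀ {p} → p ∈ S → InTriangle n p)

module Submission where

-- Projecting (a , b , c) ↦ (a + 1 , b + 1) embeds Δₙ into [n]², injectively because c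
-- is determined by a + b + c = n - 1. A skew corner (x , y), (x , y + d), (x + d , y'')
-- of the image lifts to points (a , b , c), (a , b + d , c'), (a + d , b'' , c'') of S,
-- and a + d = a + (b + d) - b is exactly what the skew condition for the identity
-- permutation forbids.

open import Defs
open import Data.Nat using (ℕ; suc; _≤_; s≤s; z≤n)
open import Data.Nat.Properties using (+-cancelˡ-≡; m≤m+n; m≤n+m; ≤-trans; ≤-reflexive)
open import Data.Integer using (ℤ; +_; 1ℤ; pred)
open import Data.Integer.Properties using (pred-suc; +-inverseʳ)
open import Data.Integer.Tactic.RingSolver using (solve-∀)
open import Data.List using (List; map; length)
open import Data.List.Properties using (length-map)
open import Data.List.Membership.Propositional using (_∈_)
open import Data.List.Membership.Propositional.Properties using (∈-map⁻)
open import Data.List.Relation.Unary.All as All using (All; []; _∷_)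
open import Data.List.Relation.Unary.All.Properties as All using ()
open import Data.List.Relation.Unary.AllPairs using ([]; _∷_)
open import Data.List.Relation.Unary.Unique.Propositional using (Unique)
open import Data.Product using (_×_; _,_; ∃-syntax)
import Data.Fin.Permutation as Permutation
open import Relation.Binary.PropositionalEquality
open import Level using (Level)

private
  variable
    ℓ ℓ₁ ℓ₂ : Level
    A : Set ℓ₁
    B : Set ℓ₂

map⁺-injectiveOn : {P : A → Set ℓ} (f : A → B) →
                   (∀ {x y} → P x → P y → f x ≡ f y → x ≡ y) →
                   ∀ {xs} → All P xs → Unique xs → Unique (map f xs)
map⁺-injectiveOn f inj [] [] = []
map⁺-injectiveOn f inj (px ∷ pxs) (x∉xs ∷ xs!) =
  All.map⁺ (All.zipWith (λ (x≢y , py) fx≡fy → x≢y (inj px py fx≡fy)) (x∉xs , pxs))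
  ∷ map⁺-injectiveOn f inj pxs xs!

module _ where
  open import Data.Nat using (_+_)

  toGrid : Point3 → Point2
  toGrid (a , b , c) = suc a , suc b

  toGrid-injectiveOn : ∀ {n p q} → InTriangle n p → InTriangle n q → toGrid p ≡ toGrid q → p ≡ q
  toGrid-injectiveOn {p = a , b , c} {q = .a , .b , c'} Δp Δq refl =
    cong (λ z → a , b , z) (+-cancelˡ-≡ (a + b) c c' (trans Δp (sym Δq)))

  toGrid-inGrid : ∀ {n p} → 1 ≤ n → InTriangle n p → InGrid n (toGrid p)
  toGrid-inGrid {suc m} {a , b , c} _ refl =
    (s≤s z≤n , s≤s (≤-trans (m≤m+n a b) (m≤m+n (a + b) c))) ,
    (s≤s z≤n , s≤s (≤-trans (m≤n+m b a) (m≤m+n (a + b) c)))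

toGrid-isGridSubset : ∀ {n S} → 1 ≤ n → IsTriangleSubset n S → IsGridSubset n (map toGrid S)
toGrid-isGridSubset {n} {S} 1≤n (S! , S⊆Δ) =
  map⁺-injectiveOn toGrid (toGrid-injectiveOn {n}) (All.tabulate S⊆Δ) S! , inGrid
  where
  inGrid : ∀ {q} → q ∈ map toGrid S → InGrid n q
  inGrid q∈ with ∈-map⁻ toGrid q∈
  ... | _ , p∈S , refl = toGrid-inGrid 1≤n (S⊆Δ p∈S)

module _ where
  open import Data.Integer using (_+_; _-_) renaming (suc to sucℤ)

  sucℤ-injective : ∀ {i j} → sucℤ i ≡ sucℤ j → i ≡ j
  sucℤ-injective {i} {j} eq = trans (sym (pred-suc i)) (trans (cong pred eq) (pred-suc j))

  step≡difference : ∀ {y y' d : ℤ} → y' ≡ y + d → d ≡ y' - y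
  step≡difference {y} {d = d} refl = identity y d
    where
    identity : ∀ y d → d ≡ (y + d) - y
    identity = solve-∀

  -- Grid coordinates are triangle coordinates shifted by one.
  skewCorner⇒skewTriple : ∀ x y x' y' d → sucℤ y' ≡ sucℤ y + d → sucℤ x' ≡ sucℤ x + d →
                          x' ≡ (x + y') - y
  skewCorner⇒skewTriple x y x' y' d y'≡y+d x'≡x+d = sucℤ-injective (begin
    sucℤ x'                     ≡⟨ x'≡x+d ⟩
    sucℤ x + d                  ≡⟨ cong (λ e → sucℤ x + e) (step≡difference y'≡y+d) ⟩
    sucℤ x + (sucℤ y' - sucℤ y) ≡⟨ identity x y y' ⟩
    sucℤ ((x + y') - y)         ∎)
    where
    open ≡-Reasoning
    identity : ∀ x y y' → (1ℤ + x) + ((1ℤ + y') - (1ℤ + y)) ≡ 1ℤ + ((x + y') - y)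
    identity = solve-∀

toGrid-skewCornerFree : ∀ {S} → SkewProp Permutation.id S → SkewCornerFree2 (map toGrid S)
toGrid-skewCornerFree skew x y y' x'' y'' d d≢0 xy∈ xy'∈ x''y''∈ y'≡y+d x''≡x+d
  with ∈-map⁻ toGrid xy∈ | ∈-map⁻ toGrid xy'∈ | ∈-map⁻ toGrid x''y''∈
... | (a , b , c) , abc∈S , refl | (.a , b' , c') , ab'c'∈S , refl | (a'' , b'' , c'') , q∈S , refl =
  skew a b' c' b c (a'' , b'' , c'')
       (_ , ab'c'∈S , refl) (_ , abc∈S , refl) b'≢b (_ , q∈S , refl)
       (skewCorner⇒skewTriple (+ a) (+ b) (+ a'') (+ b') d y'≡y+d x''≡x+d)
  where
  b'≢b : b' ≢ b
  b'≢b refl = d≢0 (trans (step≡difference {y = + suc b} y'≡y+d) (+-inverseʳ (+ suc b)))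

proposition4p15 : ∀ (n : ℕ) → 1 ≤ n → ∀ (S : List Point3) → IsTriangleSubset n S → SkewCornerFree3 S →
                    ∃[ T ] (IsGridSubset n T × SkewCornerFree2 T × length S ≤ length T)
proposition4p15 n 1≤n S S⊆Δ skew =
  map toGrid S ,
  toGrid-isGridSubset 1≤n S⊆Δ ,
  toGrid-skewCornerFree (skew Permutation.id) ,
  ≤-reflexive (sym (length-map toGrid S))
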